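{- Let $P=\langle Q,\mathrm{Instrs},\delta\rangle$ be a single process and consider the TSO transition system of the single-process program $\langle P\rangle$. For all TSO configurations $c_1,c_2,c_3$ of $\langle P\rangle$ and every label $\lambda\in\mathrm{Instrs}\cup\{\mathrm{up}^*\}$ such that $c_1\equiv c_2$ and $c_1\xrightarrow{\lambda}c_3$, there exists a configuration $c_4$ with $c_3\equiv c_4$ and $c_2\xrightarrow{\lambda}c_4$.
   Context: Let $V$ be a finite data domain and $X$ a finite set of shared variables over $V$. Instructions $\mathrm{Instrs}$ are $\mathrm{rd}(x,d)$, $\mathrm{wr}(x,d)$ ($x\in X,d\in V$), $\mathrm{skip}$, $\mathrm{mf}$. A process is a finite labelled transition system $\langle Q,\mathrm{Instrs},\delta\rangle$. For a single process, a TSO configuration is $c=\langle q,b,m\rangle$ with $q\in Q$, buffer $b\in(X\times V)^*$ (new messages added on the left, oldest on the right) and memory $m:X\to V$. Transitions: $\mathrm{rd}(x,d)$ along an edge $q\xrightarrow{\mathrm{rd}(x,d)}q'$ is enabled if the most recent buffer message on $x$ is $\langle x,d\rangle$, or if there is no buffer message on $x$ and $m(x)=d$; $\mathrm{wr}(x,d)$ moves to $q'$ and prepends $\langle x,d\rangle$ to $b$; $\mathrm{skip}$ only changes the state; $\mathrm{mf}$ is enabled only if $b=\varepsilon$; an update removes the oldest message $\langle x,d\rangle$ of $b$ and sets $m(x)=d$. $c\xrightarrow{\mathrm{up}^*}c'$ means $c'$ is obtained by zero or more updates; $c\xrightarrow{i}c'$ for $i\in\mathrm{Instrs}$ means an instruction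 transition with instruction $i$. The view of a configuration $c=\langle q,b,m\rangle$ is $\mathrm{view}(c)=\langle q,\mathrm{val},f\rangle$ where for each $x\in X$, $\mathrm{val}(x)=d$ if the most recent message on $x$ in $b$ is $\langle x,d\rangle$, and $\mathrm{val}(x)=m(x)$ if $b$ has no message on $x$; and $f=\mathrm{true}$ iff $b=\varepsilon$. Write $c_1\equiv c_2$ iff $\mathrm{view}(c_1)=\mathrm{view}(c_2)$. -}

module Defs where

open import Data.Nat using (ℕ)
open import Data.Fin using (Fin; _≟_)
open import Data.Bool using (Bool; true; false)
open import Data.Maybe using (Maybe; just; nothing; maybe)
open import Data.List using (List; []; _∷_; _++_; [_])
open import Data.List.Membership.Propositional using (_∈_)
open import Data.Vec using (Vec; lookup; tabulate; _[_]≔_)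
open import Data.Product using (_×_; _,_)
open import Data.Sum using (_⊎_)
open import Relation.Nullary using (yes; no)
open import Relation.Binary.PropositionalEquality using (_≡_)
open import Relation.Binary.Construct.Closure.ReflexiveTransitive using (Star)

module TSO (nX nV : ℕ) where

  Var : Set
  Var = Fin nX

  Val : Set
  Val = Fin nV

  data Instr : Set where
    rd   : Var → Val → Instr
    wr   : Var → Val → Instr
    skip : Instr
    mf   : Instr

  record Process : Set where
    field
      nQ : ℕ
      δ  : List (Fin nQ × Instr × Fin nQ)

  Msg : Set
  Msg = Var × Val

  -- Buffer: newest message at the head (left), oldest at the end (right).
  Buffer : Set
  Buffer = List Msg

  Memory : Set
  Memory = Vec Val nX

  latest : Buffer → Var → Maybe Val
  latest [] x = nothing
  latest ((y , d) ∷ b) x with y ≟ x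
  ... | yes _ = just d
  ... | no _  = latest b x

  isEmpty : Buffer → Bool
  isEmpty []      = true
  isEmpty (_ ∷ _) = false

  module _ (P : Process) where
    open Process P

    State : Set
    State = Fin nQ

    record Config : Set where
      constructor ⟨_,_,_⟩
      field
        state  : State
        buffer : Buffer
        memory : Memory

    data Step : Instr → Config → Config → Set where
      step-rd : ∀ {q q' b m x d} → (q , rd x d , q') ∈ δ →
                (latest b x ≡ just d ⊎ (latest b x ≡ nothing × lookup m x ≡ d)) →
                Step (rd x d) ⟨ q , b , m ⟩ ⟨ q' , b , m ⟩
      step-wr : ∀ {q q' b m x d} → (q , wr x d , q') ∈ δ →
                Step (wr x d) ⟨ q , b , m ⟩ ⟨ q' , (x , d) ∷ b , m ⟩
      step-skip : ∀ {q q' b m} → (q , skip , q') ∈ δ →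
                Step skip ⟨ q , b , m ⟩ ⟨ q' , b , m ⟩
      step-mf : ∀ {q q' b m} → (q , mf , q') ∈ δ → b ≡ [] →
                Step mf ⟨ q , b , m ⟩ ⟨ q' , b , m ⟩

    data Update : Config → Config → Set where
      update : ∀ {q b m x d} →
               Update ⟨ q , b ++ [ (x , d) ] , m ⟩ ⟨ q , b , m [ x ]≔ d ⟩

    Updates : Config → Config → Set
    Updates = Star Update

    data Label : Set where
      instr : Instr → Label
      up*   : Label

    _—[_]→_ : Config → Label → Config → Set
    c —[ instr i ]→ c' = Step i c c'
    c —[ up* ]→ c'     = Updates c c'

    val : Config → Var → Val
    val ⟨ q , b , m ⟩ x = maybe (λ d → d) (lookup m x) (latest b x)

    View : Set
    View = State × Vec Val nX × Bool

    view : Config → View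
    view c@(⟨ q , b , m ⟩) = q , tabulate (val c) , isEmpty b

    _≋_ : Config → Config → Set
    c₁ ≋ c₂ = view c₁ ≡ view c₂

-- An instruction depends on and changes only the view: a read returns the latest value
-- of its variable, mf tests the emptiness flag, a write changes one latest value and
-- clears the flag.  An update changes neither the state nor any latest value and can
-- only set the flag, so a run of updates from c₁ is matched from c₂ by no update at all
-- if the buffer stays non-empty, and by flushing the whole buffer of c₂ otherwise.
module Submission where

open import Defs
open import Data.Nat using (ℕ)
open import Data.Product using (∃; _×_; _,_; proj₁; proj₂)
open import Data.Fin using (_≟_)
open import Data.Bool using (true; false)
open import Data.Maybe using (just; nothing; maybe)
open import Data.List using ([]; _∷_; _++_; [_])
open import Data.Vec using (Vec; lookup; tabulate; _[_]≔_)
open import Data.Vec.Properties using (lookup∘update; lookup∘update′; lookup∘tabulate; tabulate-cong)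
open import Data.Sum using (_⊎_; inj₁; inj₂)
open import Function using (_∘_)
open import Relation.Nullary using (yes; no)
open import Relation.Binary.PropositionalEquality using (_≡_; refl; sym; trans; cong; cong₂; module ≡-Reasoning)
open import Relation.Binary.Construct.Closure.ReflexiveTransitive using (ε; _◅_; _◅◅_; gmap)

module Simulation {nX nV : ℕ} (P : TSO.Process nX nV) where
  open TSO nX nV
  open Config

  infix 4 _≈_
  _≈_ : Config P → Config P → Set
  _≈_ = _≋_ P

  contents : Config P → State P × Vec Val nX
  contents c = state c , tabulate (val P c)

  ≈-intro : ∀ c c' → contents c ≡ contents c' →
            isEmpty (buffer c) ≡ isEmpty (buffer c') → c ≈ c'
  ≈-intro _ _ = cong₂ (λ s f → proj₁ s , proj₂ s , f)

  ≈-contents : ∀ c c' → c ≈ c' → contents c ≡ contents c'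
  ≈-contents _ _ = cong (λ v → proj₁ v , proj₁ (proj₂ v))

  ≈-state : ∀ c c' → c ≈ c' → state c ≡ state c'
  ≈-state _ _ = cong proj₁

  ≈-val : ∀ c c' → c ≈ c' → ∀ x → val P c x ≡ val P c' x
  ≈-val c c' c≈c' x = begin
    val P c x                         ≡⟨ lookup∘tabulate (val P c) x ⟨
    lookup (proj₂ (contents c)) x     ≡⟨ cong (λ v → lookup (proj₂ v) x) (≈-contents c c' c≈c') ⟩
    lookup (proj₂ (contents c')) x    ≡⟨ lookup∘tabulate (val P c') x ⟩
    val P c' x                        ∎
    where open ≡-Reasoning

  ≈-isEmpty : ∀ c c' → c ≈ c' → isEmpty (buffer c) ≡ isEmpty (buffer c')
  ≈-isEmpty _ _ = cong (λ v → proj₂ (proj₂ v))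

  ≈-setState : ∀ c c' (q : State P) → c ≈ c' →
               ⟨ q , buffer c , memory c ⟩ ≈ ⟨ q , buffer c' , memory c' ⟩
  ≈-setState _ _ q = cong (λ v → q , proj₂ v)

  ≈-write : ∀ c c' (q : State P) x d → c ≈ c' →
            ⟨ q , (x , d) ∷ buffer c , memory c ⟩ ≈ ⟨ q , (x , d) ∷ buffer c' , memory c' ⟩
  ≈-write c c' q x d c≈c' =
    ≈-intro ⟨ q , (x , d) ∷ buffer c , memory c ⟩ ⟨ q , (x , d) ∷ buffer c' , memory c' ⟩
            (cong (q ,_) (tabulate-cong val-written)) refl
    where
    val-written : ∀ y → val P ⟨ q , (x , d) ∷ buffer c , memory c ⟩ y
                      ≡ val P ⟨ q , (x , d) ∷ buffer c' , memory c' ⟩ y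
    val-written y with x ≟ y
    ... | yes _ = refl
    ... | no _  = ≈-val c c' c≈c' y

  isEmpty≡true⇒≡[] : ∀ b → isEmpty b ≡ true → b ≡ []
  isEmpty≡true⇒≡[] [] _ = refl

  Readable : Config P → Var → Val → Set
  Readable c x d = latest (buffer c) x ≡ just d
                 ⊎ (latest (buffer c) x ≡ nothing × lookup (memory c) x ≡ d)

  readable⇒val : ∀ c {x d} → Readable c x d → val P c x ≡ d
  readable⇒val c {x} (inj₁ latest≡d) = cong (maybe (λ d → d) (lookup (memory c) x)) latest≡d
  readable⇒val c {x} (inj₂ (latest≡nothing , m≡d)) =
    trans (cong (maybe (λ d → d) (lookup (memory c) x)) latest≡nothing) m≡d

  val⇒readable : ∀ c {x d} → val P c x ≡ d → Readable c x d
  val⇒readable c {x} with latest (buffer c) x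
  ... | just _  = λ v≡d → inj₁ (cong just v≡d)
  ... | nothing = λ m≡d → inj₂ (refl , m≡d)

  step-simulation : ∀ {i} c₁ c₂ {c₃} → c₁ ≈ c₂ → Step P i c₁ c₃ →
                    ∃ λ c₄ → c₃ ≈ c₄ × Step P i c₂ c₄
  step-simulation c₁ c₂@(⟨ q₂ , b₂ , m₂ ⟩) c₁≈c₂ s with ≈-state c₁ c₂ c₁≈c₂
  step-simulation c₁ c₂@(⟨ q₂ , b₂ , m₂ ⟩) c₁≈c₂ (step-rd {q' = q'} {x = x} e readable) | refl =
    ⟨ q' , b₂ , m₂ ⟩ , ≈-setState c₁ c₂ q' c₁≈c₂ ,
    step-rd e (val⇒readable c₂ (trans (sym (≈-val c₁ c₂ c₁≈c₂ x)) (readable⇒val c₁ readable)))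
  step-simulation c₁ c₂@(⟨ q₂ , b₂ , m₂ ⟩) c₁≈c₂ (step-wr {q' = q'} {x = x} {d} e) | refl =
    ⟨ q' , (x , d) ∷ b₂ , m₂ ⟩ , ≈-write c₁ c₂ q' x d c₁≈c₂ , step-wr e
  step-simulation c₁ c₂@(⟨ q₂ , b₂ , m₂ ⟩) c₁≈c₂ (step-skip {q' = q'} e) | refl =
    ⟨ q' , b₂ , m₂ ⟩ , ≈-setState c₁ c₂ q' c₁≈c₂ , step-skip e
  step-simulation c₁ c₂@(⟨ q₂ , b₂ , m₂ ⟩) c₁≈c₂ (step-mf {q' = q'} e refl) | refl =
    ⟨ q' , b₂ , m₂ ⟩ , ≈-setState c₁ c₂ q' c₁≈c₂ ,
    step-mf e (isEmpty≡true⇒≡[] b₂ (sym (≈-isEmpty c₁ c₂ c₁≈c₂)))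

  update-preserves-val : ∀ {c c'} → Update P c c' → ∀ y → val P c y ≡ val P c' y
  update-preserves-val (update {q} {b} {m} {x} {d}) = oldest-to-memory b
    where
    oldest-to-memory : ∀ b y → val P ⟨ q , b ++ [ (x , d) ] , m ⟩ y ≡ val P ⟨ q , b , m [ x ]≔ d ⟩ y
    oldest-to-memory [] y with x ≟ y
    ... | yes refl = sym (lookup∘update x m d)
    ... | no x≢y   = sym (lookup∘update′ (x≢y ∘ sym) m d)
    oldest-to-memory ((z , _) ∷ b) y with z ≟ y
    ... | yes _ = refl
    ... | no _  = oldest-to-memory b y

  update-preserves-contents : ∀ {c c'} → Update P c c' → contents c ≡ contents c'
  update-preserves-contents u@update = cong (_ ,_) (tabulate-cong (update-preserves-val u))

  updates-preserve-contents : ∀ {c c'} → Updates P c c' → contents c ≡ contents c'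
  updates-preserve-contents ε       = refl
  updates-preserve-contents (u ◅ s) = trans (update-preserves-contents u) (updates-preserve-contents s)

  update-source-nonempty : ∀ {c c'} → Update P c c' → isEmpty (buffer c) ≡ false
  update-source-nonempty (update {b = []})    = refl
  update-source-nonempty (update {b = _ ∷ _}) = refl

  updates-into-nonempty : ∀ {c c'} → Updates P c c' →
                          isEmpty (buffer c') ≡ false → isEmpty (buffer c) ≡ false
  updates-into-nonempty ε       c'-nonempty = c'-nonempty
  updates-into-nonempty (u ◅ _) _           = update-source-nonempty u

  push : Msg → Config P → Config P
  push msg c = ⟨ state c , msg ∷ buffer c , memory c ⟩

  update-push : ∀ msg {c c'} → Update P c c' → Update P (push msg c) (push msg c')
  update-push msg update = update

  flush : ∀ c → ∃ λ m → Updates P c ⟨ state c , [] , m ⟩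
  flush ⟨ q , [] , m ⟩ = m , ε
  flush ⟨ q , msg@(x , d) ∷ b , m ⟩ with flush ⟨ q , b , m ⟩
  ... | m' , s = m' [ x ]≔ d , gmap (push msg) (update-push msg) s ◅◅ (update {b = []} ◅ ε)

  updates-simulation : ∀ c₁ c₂ {c₃} → c₁ ≈ c₂ → Updates P c₁ c₃ →
                       ∃ λ c₄ → c₃ ≈ c₄ × Updates P c₂ c₄
  updates-simulation c₁ c₂ {c₃@(⟨ _ , _ ∷ _ , _ ⟩)} c₁≈c₂ s =
    c₂ , trans (sym c₁≈c₃) c₁≈c₂ , ε
    where
    c₁≈c₃ : c₁ ≈ c₃
    c₁≈c₃ = ≈-intro c₁ c₃ (updates-preserve-contents s) (updates-into-nonempty s refl)
  updates-simulation c₁ c₂ {c₃@(⟨ _ , [] , _ ⟩)} c₁≈c₂ s with flush c₂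
  ... | m , s' = c₄ , ≈-intro c₃ c₄ contents₃≡contents₄ refl , s'
    where
    c₄ : Config P
    c₄ = ⟨ state c₂ , [] , m ⟩
    contents₃≡contents₄ : contents c₃ ≡ contents c₄
    contents₃≡contents₄ = begin
      contents c₃ ≡⟨ updates-preserve-contents s ⟨
      contents c₁ ≡⟨ ≈-contents c₁ c₂ c₁≈c₂ ⟩
      contents c₂ ≡⟨ updates-preserve-contents s' ⟩
      contents c₄ ∎
      where open ≡-Reasoning

lemma3 : (nX nV : ℕ) (P : TSO.Process nX nV) →
    ∀ (c₁ c₂ c₃ : TSO.Config nX nV P) (λ' : TSO.Label nX nV P) →
    TSO._≋_ nX nV P c₁ c₂ →
    TSO._—[_]→_ nX nV P c₁ λ' c₃ →
    ∃ λ c₄ → TSO._≋_ nX nV P c₃ c₄ × TSO._—[_]→_ nX nV P c₂ λ' c₄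
lemma3 nX nV P c₁ c₂ c₃ (TSO.instr i) = Simulation.step-simulation P c₁ c₂
lemma3 nX nV P c₁ c₂ c₃ TSO.up*       = Simulation.updates-simulation P c₁ c₂
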